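{- Let $\mathbb{F}$ be a prime field with $\operatorname{char}(\mathbb{F})\neq2$, $M\in\mathbb{F}^2$, $r\in\mathbb{F}^{*}$ and $q\in\square_{\mathbb{F}^{*}}$. If $q\neq4r^2$ and there exist two points $P_1,P_2\in C(M,r)_{\mathbb{F}}$ with $D^2(P_1,P_2)=q$, then $q$ is a perfect distance with respect to $C(M,r)_{\mathbb{F}}$.
   Context: $\square_K=\{a^2:a\in K\}$, $\mathbb{F}^{*}=\mathbb{F}\setminus\{0\}$. $C(M,r)_{\mathbb{F}}=\{(x,y)\in\mathbb{F}^2:(x-m_1)^2+(y-m_2)^2=r^2\}$ for $M=(m_1,m_2)$. $D^2((p_1,p_2),(q_1,q_2))=(p_1-q_1)^2+(p_2-q_2)^2$; two points have rational squared distance if their squared distance is a square in the prime field (here $\mathbb{F}$). $q$ is a perfect distance with respect to $C(M,r)_{\mathbb{F}}$ if $q=D^2(A,B)$ for two points $A,B$ on the circle with rational squared distance and there is a third point $X$ on the circle, with $A,B,X$ pairwise different, such that all squared distances among $A,B,X$ are rational. -}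

module Defs where

open import Data.Nat as ℕ using (ℕ; suc)
open import Data.Nat.DivMod using (_mod_)
open import Data.Fin using (Fin; toℕ)
open import Data.Rational as ℚ using (ℚ)
open import Data.Product using (_×_; ∃; ∃-syntax; _,_)
open import Relation.Binary.PropositionalEquality using (_≡_; _≢_)

record FieldOps : Set₁ where
  field
    Car : Set
    0# 1# : Car
    _+_ _-_ _*_ : Car → Car → Car

FpOps : ℕ → FieldOps
FpOps n = record
  { Car = Fin p
  ; 0# = 0 mod p
  ; 1# = 1 mod p
  ; _+_ = λ a b → (toℕ a ℕ.+ toℕ b) mod p
  ; _-_ = λ a b → (toℕ a ℕ.+ (p ℕ.∸ toℕ b)) mod p
  ; _*_ = λ a b → (toℕ a ℕ.* toℕ b) mod p
  }
  where p = suc n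

ℚOps : FieldOps
ℚOps = record
  { Car = ℚ ; 0# = ℚ.0ℚ ; 1# = ℚ.1ℚ ; _+_ = ℚ._+_ ; _-_ = ℚ._-_ ; _*_ = ℚ._*_ }

module _ (O : FieldOps) where
  open FieldOps O

  Point : Set
  Point = Car × Car

  IsSquare : Car → Set
  IsSquare x = ∃[ a ] a * a ≡ x

  D² : Point → Point → Car
  D² (p₁ , p₂) (q₁ , q₂) = ((p₁ - q₁) * (p₁ - q₁)) + ((p₂ - q₂) * (p₂ - q₂))

  OnCircle : Point → Car → Point → Set
  OnCircle (m₁ , m₂) r (x , y) = ((x - m₁) * (x - m₁)) + ((y - m₂) * (y - m₂)) ≡ r * r

  -- rational squared distance (F is its own prime field)
  RationalSqDist : Point → Point → Set
  RationalSqDist P Q = IsSquare (D² P Q)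

  PerfectDistance : Point → Car → Car → Set
  PerfectDistance M r q =
    ∃[ A ] ∃[ B ] ∃[ X ]
      OnCircle M r A × OnCircle M r B × OnCircle M r X ×
      A ≢ B × A ≢ X × B ≢ X ×
      D² A B ≡ q ×
      RationalSqDist A B × RationalSqDist A X × RationalSqDist B X

  Theorem12For : Set
  Theorem12For =
    ∀ (M : Point) (r q : Car) →
      r ≢ 0# → q ≢ 0# → IsSquare q →
      q ≢ ((1# + 1#) * (1# + 1#)) * (r * r) →
      (∃[ P₁ ] ∃[ P₂ ] OnCircle M r P₁ × OnCircle M r P₂ × D² P₁ P₂ ≡ q) →
      PerfectDistance M r q

-- Put the centre M at the origin: u = A - M and v = B - M satisfy |u|² = |v|² = r², and
-- |u - v|² = q = a². Mirroring A in the vertical line through M gives a point X of the circle with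
-- X - M = (-u₁, u₂) and |A - X|² = (2u₁)². For points of a common circle
-- |u - v|²·|v - (-u₁, u₂)|² = (2r(u₂ - v₂))², so |B - X|² = (2r(u₂ - v₂)/a)² is a square too;
-- likewise for the mirror in the horizontal line. The two mirrors compose to the point reflection
-- in M. Since A ≠ M (as r ≠ 0) and B is not the antipode of A (as q ≠ 4r²), one of the two mirror
-- images of A differs from both A and B.

module Submission where

open import Defs
open import Data.Nat using (ℕ; suc)
open import Data.Nat.Primality using (Prime)
open import Data.Product using (_×_)
open import Relation.Binary.PropositionalEquality using (_≢_)

open import Level using (Level; 0ℓ)
open import Algebra.Bundles using (CommutativeRing; RawRing)
open import Algebra.Structures using (IsCommutativeRing)
open import Algebra.Definitions using (Associative; Commutative; LeftIdentity; LeftInverse; _DistributesOverˡ_)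
open import Algebra.Consequences.Propositional using (comm∧idˡ⇒id; comm∧invˡ⇒inv; comm∧distrˡ⇒distrʳ)
import Algebra.Solver.Ring
import Algebra.Solver.Ring.AlmostCommutativeRing as ACR
open import Data.Empty using (⊥-elim)
open import Data.Fin.Base using (toℕ)
open import Data.Fin.Properties using (toℕ-fromℕ<; toℕ-injective; toℕ<n) renaming (_≟_ to _≟ᶠ_)
open import Data.Integer.Base as ℤ using (ℤ; +_; -[1+_]; _⊖_; sign; ∣_∣; _◃_)
import Data.Integer.Properties as ℤ
open import Data.Maybe.Base using (Maybe; just; nothing)
open import Data.Nat.Base as ℕ using (zero; _%_; ≢-nonZero)
import Data.Nat.Properties as ℕ
open import Data.Nat.DivMod using (_mod_; m%n<n; m<n⇒m%n≡m; m%n%n≡m%n; %-distribˡ-+; %-distribˡ-*; n%n≡0; m*n%n≡0; [m+kn]%n≡m%n)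
open import Data.Nat.Coprimality using (coprime-Bézout; prime⇒coprime)
import Data.Nat.GCD as GCD
open import Data.Nat.Primality using (¬prime[1])
open import Data.Product.Base using (_,_; ∃-syntax; proj₁; proj₂; swap)
open import Data.Product.Properties using (≡-dec)
import Data.Rational as ℚ
import Data.Rational.Properties as ℚ
open import Data.Sign.Base as Sign using (Sign)
open import Function.Base using (_∘_)
import Relation.Binary.PropositionalEquality as ≡
open import Relation.Binary.Definitions using (DecidableEquality)
open import Relation.Nullary using (yes; no)

-- Elements of an abstract ring cannot serve as solver coefficients (their equality does not
-- compute), so coefficients are taken in ℤ and interpreted through the initial map ℤ → R.
module IntegerCoefficients {c ℓ : Level} (R : CommutativeRing c ℓ) where
  open CommutativeRing R
  open import Algebra.Properties.Ring ring using (-0#≈0#; -‿+-comm; -‿involutive; -‿distribˡ-*; -‿distribʳ-*)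
  open import Algebra.Properties.Semiring.Mult.TCOptimised semiring
    using (1+×; ×-homo-+; ×1-homo-*) renaming (_×_ to _·_)
  open import Relation.Binary.Reasoning.Setoid setoid

  fromℕ : ℕ → Carrier
  fromℕ n = n · 1#

  fromℤ : ℤ → Carrier
  fromℤ (+ n)    = fromℕ n
  fromℤ -[1+ n ] = - fromℕ (suc n)

  private
    1+x-[1+y]≈x-y : ∀ x y → (1# + x) - (1# + y) ≈ x - y
    1+x-[1+y]≈x-y x y = begin
      (1# + x) + - (1# + y)   ≈⟨ +-cong (+-comm 1# x) (sym (-‿+-comm 1# y)) ⟩
      (x + 1#) + (- 1# + - y) ≈⟨ +-assoc x 1# _ ⟩
      x + (1# + (- 1# + - y)) ≈⟨ +-congˡ (sym (+-assoc 1# (- 1#) (- y))) ⟩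
      x + ((1# - 1#) + - y)   ≈⟨ +-congˡ (+-congʳ (-‿inverseʳ 1#)) ⟩
      x + (0# + - y)          ≈⟨ +-congˡ (+-identityˡ (- y)) ⟩
      x - y                   ∎

    signed : Sign → Carrier → Carrier
    signed Sign.+ x = x
    signed Sign.- x = - x

    signed-cong : ∀ s {x y} → x ≈ y → signed s x ≈ signed s y
    signed-cong Sign.+ x≈y = x≈y
    signed-cong Sign.- x≈y = -‿cong x≈y

    signed-* : ∀ s t x y → signed (s Sign.* t) (x * y) ≈ signed s x * signed t y
    signed-* Sign.+ Sign.+ x y = refl
    signed-* Sign.+ Sign.- x y = -‿distribʳ-* x y
    signed-* Sign.- Sign.+ x y = -‿distribˡ-* x y
    signed-* Sign.- Sign.- x y = begin
      x * y         ≈⟨ sym (-‿involutive (x * y)) ⟩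
      - - (x * y)   ≈⟨ -‿cong (-‿distribʳ-* x y) ⟩
      - (x * - y)   ≈⟨ -‿distribˡ-* x (- y) ⟩
      - x * - y     ∎

    fromℤ-◃ : ∀ s n → fromℤ (s ◃ n) ≈ signed s (fromℕ n)
    fromℤ-◃ Sign.+ zero    = refl
    fromℤ-◃ Sign.- zero    = sym -0#≈0#
    fromℤ-◃ Sign.+ (suc n) = refl
    fromℤ-◃ Sign.- (suc n) = refl

    fromℤ-signAbs : ∀ i → fromℤ i ≈ signed (sign i) (fromℕ ∣ i ∣)
    fromℤ-signAbs (+ n)    = refl
    fromℤ-signAbs -[1+ n ] = refl

  fromℤ-⊖ : ∀ m n → fromℤ (m ⊖ n) ≈ fromℕ m - fromℕ n
  fromℤ-⊖ m       zero    = begin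
    fromℕ m        ≈⟨ sym (+-identityʳ (fromℕ m)) ⟩
    fromℕ m + 0#   ≈⟨ +-congˡ (sym -0#≈0#) ⟩
    fromℕ m - 0#   ∎
  fromℤ-⊖ zero    (suc n) = sym (+-identityˡ _)
  fromℤ-⊖ (suc m) (suc n) = begin
    fromℤ (suc m ⊖ suc n)           ≡⟨ ≡.cong fromℤ (ℤ.[1+m]⊖[1+n]≡m⊖n m n) ⟩
    fromℤ (m ⊖ n)                   ≈⟨ fromℤ-⊖ m n ⟩
    fromℕ m - fromℕ n               ≈⟨ 1+x-[1+y]≈x-y (fromℕ m) (fromℕ n) ⟨
    (1# + fromℕ m) - (1# + fromℕ n) ≈⟨ +-cong (1+× m 1#) (-‿cong (1+× n 1#)) ⟨
    fromℕ (suc m) - fromℕ (suc n)   ∎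

  fromℤ-+ : ∀ i j → fromℤ (i ℤ.+ j) ≈ fromℤ i + fromℤ j
  fromℤ-+ -[1+ m ] -[1+ n ] = begin
    - fromℕ (suc (suc (m ℕ.+ n)))     ≡⟨ ≡.cong (λ k → - fromℕ (suc k)) (ℕ.+-suc m n) ⟨
    - fromℕ (suc m ℕ.+ suc n)         ≈⟨ -‿cong (×-homo-+ 1# (suc m) (suc n)) ⟩
    - (fromℕ (suc m) + fromℕ (suc n)) ≈⟨ -‿+-comm _ _ ⟨
    - fromℕ (suc m) + - fromℕ (suc n) ∎
  fromℤ-+ -[1+ m ] (+ n)    = trans (fromℤ-⊖ n (suc m)) (+-comm _ _)
  fromℤ-+ (+ m)    -[1+ n ] = fromℤ-⊖ m (suc n)
  fromℤ-+ (+ m)    (+ n)    = ×-homo-+ 1# m n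

  fromℤ-* : ∀ i j → fromℤ (i ℤ.* j) ≈ fromℤ i * fromℤ j
  fromℤ-* i j = begin
    fromℤ (s ◃ ∣ i ∣ ℕ.* ∣ j ∣)                  ≈⟨ fromℤ-◃ s (∣ i ∣ ℕ.* ∣ j ∣) ⟩
    signed s (fromℕ (∣ i ∣ ℕ.* ∣ j ∣))           ≈⟨ signed-cong s (×1-homo-* ∣ i ∣ ∣ j ∣) ⟩
    signed s (fromℕ ∣ i ∣ * fromℕ ∣ j ∣)         ≈⟨ signed-* (sign i) (sign j) _ _ ⟩
    signed (sign i) (fromℕ ∣ i ∣) * signed (sign j) (fromℕ ∣ j ∣)
                                                ≈⟨ *-cong (fromℤ-signAbs i) (fromℤ-signAbs j) ⟨
    fromℤ i * fromℤ j                           ∎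
    where s = sign i Sign.* sign j

  fromℤ-neg : ∀ i → fromℤ (ℤ.- i) ≈ - fromℤ i
  fromℤ-neg -[1+ n ]  = sym (-‿involutive _)
  fromℤ-neg (+ zero)  = sym -0#≈0#
  fromℤ-neg (+ suc n) = refl

  private
    ℤ-rawRing : RawRing _ _
    ℤ-rawRing = record
      { Carrier = ℤ ; _≈_ = ≡._≡_ ; _+_ = ℤ._+_ ; _*_ = ℤ._*_ ; -_ = ℤ.-_ ; 0# = + 0 ; 1# = + 1 }

    fromℤ-homomorphism : ℤ-rawRing ACR.-Raw-AlmostCommutative⟶ ACR.fromCommutativeRing R
    fromℤ-homomorphism = record
      { ⟦_⟧ = fromℤ ; +-homo = fromℤ-+ ; *-homo = fromℤ-* ; -‿homo = fromℤ-neg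
      ; 0-homo = refl ; 1-homo = refl }

    fromℤ-≟ : ∀ i j → Maybe (fromℤ i ≈ fromℤ j)
    fromℤ-≟ i j with i ℤ.≟ j
    ... | yes ≡.refl = just refl
    ... | no _       = nothing

  open Algebra.Solver.Ring ℤ-rawRing (ACR.fromCommutativeRing R) fromℤ-homomorphism fromℤ-≟ public

module _ (O : FieldOps) where
  open FieldOps O
  open ≡ using (_≡_)

  record Char≢2Field : Set where
    field
      -_                : Car → Car
      isCommutativeRing : IsCommutativeRing _≡_ _+_ _*_ -_ 0# 1#
      x-y≡x+-y          : ∀ x y → x - y ≡ x + (- y)
      _≟_               : DecidableEquality Car
      inverse           : ∀ x → x ≢ 0# → ∃[ y ] x * y ≡ 1#
      2≢0               : 1# + 1# ≢ 0#

module Circle {O : FieldOps} (F : Char≢2Field O) where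
  open FieldOps O using (Car)
  open Char≢2Field F using (isCommutativeRing; x-y≡x+-y; _≟_; inverse; 2≢0)
  open ≡ using (_≡_; refl; sym; trans; cong; cong₂; subst; module ≡-Reasoning)

  commutativeRing : CommutativeRing 0ℓ 0ℓ
  commutativeRing = record { isCommutativeRing = isCommutativeRing }

  open CommutativeRing commutativeRing
    using (_+_; _*_; -_; _-_; 0#; 1#; +-comm; zeroˡ; zeroʳ; *-identityˡ; *-identityʳ; -‿inverseʳ)
  open IntegerCoefficients commutativeRing using (solve; _:=_; _:+_; _:*_; _:-_; con)
  open ≡-Reasoning

  x*y≡0⇒y≡0 : ∀ {x y} → x ≢ 0# → x * y ≡ 0# → y ≡ 0#
  x*y≡0⇒y≡0 {x} {y} x≢0 xy≡0 with inverse x x≢0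
  ... | x⁻¹ , xx⁻¹≡1 = begin
    y              ≡⟨ *-identityˡ y ⟨
    1# * y         ≡⟨ cong (_* y) xx⁻¹≡1 ⟨
    x * x⁻¹ * y    ≡⟨ solve 3 (λ x b y → x :* b :* y := b :* (x :* y)) refl x x⁻¹ y ⟩
    x⁻¹ * (x * y)  ≡⟨ cong (x⁻¹ *_) xy≡0 ⟩
    x⁻¹ * 0#       ≡⟨ zeroʳ x⁻¹ ⟩
    0#             ∎

  x≡m+m-x⇒x-m≡0 : ∀ {x m} → x ≡ m + m - x → x - m ≡ 0#
  x≡m+m-x⇒x-m≡0 {x} {m} x≡m+m-x = x*y≡0⇒y≡0 2≢0 (begin
    (1# + 1#) * (x - m)  ≡⟨ solve 2 (λ x m → con (+ 2) :* (x :- m) := x :- (m :+ m :- x)) refl x m ⟩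
    x - (m + m - x)      ≡⟨ cong (λ t → x - t) x≡m+m-x ⟨
    x - x                ≡⟨ -‿inverseʳ x ⟩
    0#                   ∎)

  isSquare-cancelˡ : ∀ {q z} → IsSquare O q → q ≢ 0# → IsSquare O (q * z) → IsSquare O z
  isSquare-cancelˡ {q} {z} (a , a²≡q) q≢0 (c , c²≡qz) with inverse a a≢0
    where
    a≢0 : a ≢ 0#
    a≢0 a≡0 = q≢0 (trans (sym a²≡q) (trans (cong (λ t → t * t) a≡0) (zeroˡ 0#)))
  ... | a⁻¹ , aa⁻¹≡1 = c * a⁻¹ , (begin
    c * a⁻¹ * (c * a⁻¹)        ≡⟨ solve 2 (λ c b → c :* b :* (c :* b) := c :* c :* (b :* b)) refl c a⁻¹ ⟩
    c * c * (a⁻¹ * a⁻¹)        ≡⟨ cong (_* (a⁻¹ * a⁻¹)) (trans c²≡qz (cong (_* z) (sym a²≡q))) ⟩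
    a * a * z * (a⁻¹ * a⁻¹)    ≡⟨ solve 3 (λ a b z → a :* a :* z :* (b :* b) := z :* ((a :* b) :* (a :* b))) refl a a⁻¹ z ⟩
    z * ((a * a⁻¹) * (a * a⁻¹)) ≡⟨ cong (λ t → z * (t * t)) aa⁻¹≡1 ⟩
    z * (1# * 1#)              ≡⟨ cong (z *_) (*-identityʳ 1#) ⟩
    z * 1#                     ≡⟨ *-identityʳ z ⟩
    z                          ∎)

  D²-expand : ∀ p₁ p₂ q₁ q₂ →
              D² O (p₁ , p₂) (q₁ , q₂) ≡ (p₁ - q₁) * (p₁ - q₁) + (p₂ - q₂) * (p₂ - q₂)
  D²-expand p₁ p₂ q₁ q₂ rewrite x-y≡x+-y p₁ q₁ | x-y≡x+-y p₂ q₂ = refl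

  D²-self : ∀ P → D² O P P ≡ 0#
  D²-self (x , y) = trans (D²-expand x y x y)
    (solve 2 (λ x y → (x :- x) :* (x :- x) :+ (y :- y) :* (y :- y) := con (+ 0)) refl x y)

  D²-swap : ∀ P Q → D² O (swap P) (swap Q) ≡ D² O P Q
  D²-swap (_ , _) (_ , _) = +-comm _ _

  onCircle⇒D² : ∀ M r A → OnCircle O M r A → D² O A M ≡ r * r
  onCircle⇒D² (_ , _) r (_ , _) A∈C = A∈C

  D²⇒onCircle : ∀ M r A → D² O A M ≡ r * r → OnCircle O M r A
  D²⇒onCircle (_ , _) r (_ , _) AM≡rr = AM≡rr

  mirror : Point O → Point O → Point O
  mirror (m₁ , _) (x , y) = (m₁ + m₁ - x , y)

  D²-mirror-centre : ∀ M A → D² O (mirror M A) M ≡ D² O A M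
  D²-mirror-centre (m₁ , m₂) (x , y) = begin
    D² O (m₁ + m₁ - x , y) (m₁ , m₂)
      ≡⟨ D²-expand _ y m₁ m₂ ⟩
    (m₁ + m₁ - x - m₁) * (m₁ + m₁ - x - m₁) + (y - m₂) * (y - m₂)
      ≡⟨ solve 4 (λ x y m₁ m₂ →
           (m₁ :+ m₁ :- x :- m₁) :* (m₁ :+ m₁ :- x :- m₁) :+ (y :- m₂) :* (y :- m₂)
           := (x :- m₁) :* (x :- m₁) :+ (y :- m₂) :* (y :- m₂)) refl x y m₁ m₂ ⟩
    (x - m₁) * (x - m₁) + (y - m₂) * (y - m₂)
      ≡⟨ D²-expand x y m₁ m₂ ⟨
    D² O (x , y) (m₁ , m₂)
      ∎

  isSquare-D²-mirror : ∀ M A → IsSquare O (D² O A (mirror M A))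
  isSquare-D²-mirror (m₁ , m₂) (x , y) = (1# + 1#) * (x - m₁) , (begin
    (1# + 1#) * (x - m₁) * ((1# + 1#) * (x - m₁))
      ≡⟨ solve 3 (λ x y m₁ →
           con (+ 2) :* (x :- m₁) :* (con (+ 2) :* (x :- m₁))
           := (x :- (m₁ :+ m₁ :- x)) :* (x :- (m₁ :+ m₁ :- x)) :+ (y :- y) :* (y :- y)) refl x y m₁ ⟩
    (x - (m₁ + m₁ - x)) * (x - (m₁ + m₁ - x)) + (y - y) * (y - y)
      ≡⟨ D²-expand x y _ y ⟨
    D² O (x , y) (m₁ + m₁ - x , y)
      ∎)

  -- With nA = nB = r² the second summand vanishes, leaving (2r(y - y′))².
  mirror-product-identity : ∀ x y x′ y′ m₁ m₂ →
    let nA = (x - m₁) * (x - m₁) + (y - m₂) * (y - m₂)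
        nB = (x′ - m₁) * (x′ - m₁) + (y′ - m₂) * (y′ - m₂)
    in ((x - x′) * (x - x′) + (y - y′) * (y - y′))
         * ((x′ - (m₁ + m₁ - x)) * (x′ - (m₁ + m₁ - x)) + (y′ - y) * (y′ - y))
       ≡ (1# + 1#) * (1# + 1#) * nA * ((y - y′) * (y - y′))
         + (nA - nB) * (nA - nB - (1# + 1#) * (1# + 1#) * (y - m₂) * (y - y′))
  mirror-product-identity = solve 6 (λ x y x′ y′ m₁ m₂ →
    ((x :- x′) :* (x :- x′) :+ (y :- y′) :* (y :- y′))
      :* ((x′ :- (m₁ :+ m₁ :- x)) :* (x′ :- (m₁ :+ m₁ :- x)) :+ (y′ :- y) :* (y′ :- y))
    := con (+ 2) :* con (+ 2) :* ((x :- m₁) :* (x :- m₁) :+ (y :- m₂) :* (y :- m₂)) :* ((y :- y′) :* (y :- y′))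
       :+ (((x :- m₁) :* (x :- m₁) :+ (y :- m₂) :* (y :- m₂)) :- ((x′ :- m₁) :* (x′ :- m₁) :+ (y′ :- m₂) :* (y′ :- m₂)))
          :* (((x :- m₁) :* (x :- m₁) :+ (y :- m₂) :* (y :- m₂)) :- ((x′ :- m₁) :* (x′ :- m₁) :+ (y′ :- m₂) :* (y′ :- m₂))
              :- con (+ 2) :* con (+ 2) :* (y :- m₂) :* (y :- y′))) refl

  isSquare-D²-mul-D²-mirror : ∀ M r A B → D² O A M ≡ r * r → D² O B M ≡ r * r →
                              IsSquare O (D² O A B * D² O B (mirror M A))
  isSquare-D²-mul-D²-mirror (m₁ , m₂) r (x , y) (x′ , y′) AM≡rr BM≡rr =
    (1# + 1#) * r * (y - y′) , sym (begin
      D² O (x , y) (x′ , y′) * D² O (x′ , y′) (m₁ + m₁ - x , y)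
        ≡⟨ cong₂ _*_ (D²-expand x y x′ y′) (D²-expand x′ y′ _ y) ⟩
      ((x - x′) * (x - x′) + (y - y′) * (y - y′))
        * ((x′ - (m₁ + m₁ - x)) * (x′ - (m₁ + m₁ - x)) + (y′ - y) * (y′ - y))
        ≡⟨ mirror-product-identity x y x′ y′ m₁ m₂ ⟩
      four * nA * t² + (nA - nB) * (nA - nB - four * (y - m₂) * (y - y′))
        ≡⟨ cong₂ (λ a b → four * a * t² + (a - b) * (a - b - four * (y - m₂) * (y - y′)))
                 (trans (sym (D²-expand x y m₁ m₂)) AM≡rr) (trans (sym (D²-expand x′ y′ m₁ m₂)) BM≡rr) ⟩
      four * (r * r) * t² + (r * r - r * r) * (r * r - r * r - four * (y - m₂) * (y - y′))
        ≡⟨ solve 3 (λ r t s →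
             con (+ 2) :* con (+ 2) :* (r :* r) :* (t :* t)
               :+ (r :* r :- r :* r) :* (r :* r :- r :* r :- con (+ 2) :* con (+ 2) :* s :* t)
             := con (+ 2) :* r :* t :* (con (+ 2) :* r :* t)) refl r (y - y′) (y - m₂) ⟩
      (1# + 1#) * r * (y - y′) * ((1# + 1#) * r * (y - y′))
        ∎)
    where
    four t² nA nB : Car
    four = (1# + 1#) * (1# + 1#)
    t²   = (y - y′) * (y - y′)
    nA   = (x - m₁) * (x - m₁) + (y - m₂) * (y - m₂)
    nB   = (x′ - m₁) * (x′ - m₁) + (y′ - m₂) * (y′ - m₂)

  data Axis : Set where
    vertical horizontal : Axis

  other : Axis → Axis
  other vertical   = horizontal
  other horizontal = vertical

  reflect : Axis → Point O → Point O → Point O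
  reflect vertical   M A = mirror M A
  reflect horizontal M A = swap (mirror (swap M) (swap A))

  D²-reflect-centre : ∀ a M A → D² O (reflect a M A) M ≡ D² O A M
  D²-reflect-centre vertical   M A = D²-mirror-centre M A
  D²-reflect-centre horizontal M A = begin
    D² O (swap (mirror (swap M) (swap A))) M ≡⟨ D²-swap (mirror (swap M) (swap A)) (swap M) ⟩
    D² O (mirror (swap M) (swap A)) (swap M) ≡⟨ D²-mirror-centre (swap M) (swap A) ⟩
    D² O (swap A) (swap M)                   ≡⟨ D²-swap A M ⟩
    D² O A M                                 ∎

  isSquare-D²-reflect : ∀ a M A → IsSquare O (D² O A (reflect a M A))
  isSquare-D²-reflect vertical   M A = isSquare-D²-mirror M A
  isSquare-D²-reflect horizontal M A =
    subst (IsSquare O) (D²-swap A (reflect horizontal M A)) (isSquare-D²-mirror (swap M) (swap A))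

  isSquare-D²-mul-D²-reflect : ∀ a M r A B → D² O A M ≡ r * r → D² O B M ≡ r * r →
                               IsSquare O (D² O A B * D² O B (reflect a M A))
  isSquare-D²-mul-D²-reflect vertical   M r A B AM≡rr BM≡rr = isSquare-D²-mul-D²-mirror M r A B AM≡rr BM≡rr
  isSquare-D²-mul-D²-reflect horizontal M r A B AM≡rr BM≡rr =
    subst (IsSquare O) (cong₂ _*_ (D²-swap A B) (D²-swap B (reflect horizontal M A)))
      (isSquare-D²-mul-D²-mirror (swap M) r (swap A) (swap B)
        (trans (D²-swap A M) AM≡rr) (trans (D²-swap B M) BM≡rr))

  antipode : Point O → Point O → Point O
  antipode (m₁ , m₂) (x , y) = (m₁ + m₁ - x , m₂ + m₂ - y)

  D²-antipode : ∀ M A → D² O A (antipode M A) ≡ (1# + 1#) * (1# + 1#) * D² O A M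
  D²-antipode (m₁ , m₂) (x , y) = begin
    D² O (x , y) (m₁ + m₁ - x , m₂ + m₂ - y)
      ≡⟨ D²-expand x y _ _ ⟩
    (x - (m₁ + m₁ - x)) * (x - (m₁ + m₁ - x)) + (y - (m₂ + m₂ - y)) * (y - (m₂ + m₂ - y))
      ≡⟨ solve 4 (λ x y m₁ m₂ →
           (x :- (m₁ :+ m₁ :- x)) :* (x :- (m₁ :+ m₁ :- x)) :+ (y :- (m₂ :+ m₂ :- y)) :* (y :- (m₂ :+ m₂ :- y))
           := con (+ 2) :* con (+ 2) :* ((x :- m₁) :* (x :- m₁) :+ (y :- m₂) :* (y :- m₂))) refl x y m₁ m₂ ⟩
    (1# + 1#) * (1# + 1#) * ((x - m₁) * (x - m₁) + (y - m₂) * (y - m₂))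
      ≡⟨ cong ((1# + 1#) * (1# + 1#) *_) (D²-expand x y m₁ m₂) ⟨
    (1# + 1#) * (1# + 1#) * D² O (x , y) (m₁ , m₂)
      ∎

  antipode-fixed⇒D²-centre≡0 : ∀ M A → antipode M A ≡ A → D² O A M ≡ 0#
  antipode-fixed⇒D²-centre≡0 (m₁ , m₂) (x , y) A′≡A = begin
    D² O (x , y) (m₁ , m₂)                    ≡⟨ D²-expand x y m₁ m₂ ⟩
    (x - m₁) * (x - m₁) + (y - m₂) * (y - m₂) ≡⟨ cong₂ (λ s t → s * s + t * t)
                                                   (x≡m+m-x⇒x-m≡0 (sym (cong proj₁ A′≡A)))
                                                   (x≡m+m-x⇒x-m≡0 (sym (cong proj₂ A′≡A))) ⟩
    0# * 0# + 0# * 0#                         ≡⟨ solve 0 (con (+ 0) :* con (+ 0) :+ con (+ 0) :* con (+ 0) := con (+ 0)) refl ⟩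
    0#                                        ∎

  reflect-fixed⇒other≡antipode : ∀ a M A → reflect a M A ≡ A → reflect (other a) M A ≡ antipode M A
  reflect-fixed⇒other≡antipode vertical   (_ , m₂) (x , y) X≡A = cong (_, m₂ + m₂ - y) (sym (cong proj₁ X≡A))
  reflect-fixed⇒other≡antipode horizontal (m₁ , _) (x , y) X≡A = cong (m₁ + m₁ - x ,_) (sym (cong proj₂ X≡A))

  reflect-vertical≡horizontal⇒antipode-fixed : ∀ M A → reflect vertical M A ≡ reflect horizontal M A →
                                               antipode M A ≡ A
  reflect-vertical≡horizontal⇒antipode-fixed (_ , _) (_ , _) X₁≡X₂ =
    cong₂ _,_ (cong proj₁ X₁≡X₂) (sym (cong proj₂ X₁≡X₂))

  _≟ᵖ_ : DecidableEquality (Point O)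
  _≟ᵖ_ = ≡-dec _≟_ _≟_

  reflect-avoiding : ∀ M A B → A ≢ antipode M A → B ≢ antipode M A →
                     ∃[ a ] reflect a M A ≢ A × reflect a M A ≢ B
  reflect-avoiding M A B A≢A′ B≢A′ with reflect vertical M A ≟ᵖ A
  ... | yes X₁≡A = horizontal , (λ X₂≡A → A≢A′ (trans (sym X₂≡A) X₂≡A′)) , (λ X₂≡B → B≢A′ (trans (sym X₂≡B) X₂≡A′))
    where
    X₂≡A′ : reflect horizontal M A ≡ antipode M A
    X₂≡A′ = reflect-fixed⇒other≡antipode vertical M A X₁≡A
  ... | no X₁≢A with reflect vertical M A ≟ᵖ B
  ...   | no X₁≢B  = vertical , X₁≢A , X₁≢B
  ...   | yes X₁≡B = horizontal
                   , (λ X₂≡A → B≢A′ (trans (sym X₁≡B) (reflect-fixed⇒other≡antipode horizontal M A X₂≡A)))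
                   , (λ X₂≡B → A≢A′ (sym (reflect-vertical≡horizontal⇒antipode-fixed M A (trans X₁≡B (sym X₂≡B)))))

  theorem12 : Theorem12For O
  theorem12 M r q r≢0 q≢0 q-square q≢4r² (A , B , A∈C , B∈C , AB≡q) =
    let (a , X≢A , X≢B) = reflect-avoiding M A B A≢A′ B≢A′ in
    A , B , reflect a M A , A∈C , B∈C ,
    D²⇒onCircle M r (reflect a M A) (trans (D²-reflect-centre a M A) AM≡rr) ,
    A≢B , X≢A ∘ sym , X≢B ∘ sym , AB≡q , AB-square , isSquare-D²-reflect a M A ,
    isSquare-cancelˡ AB-square (q≢0 ∘ trans (sym AB≡q)) (isSquare-D²-mul-D²-reflect a M r A B AM≡rr BM≡rr)
    where
    AM≡rr : D² O A M ≡ r * r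
    AM≡rr = onCircle⇒D² M r A A∈C

    BM≡rr : D² O B M ≡ r * r
    BM≡rr = onCircle⇒D² M r B B∈C

    AB-square : IsSquare O (D² O A B)
    AB-square = subst (IsSquare O) (sym AB≡q) q-square

    A≢B : A ≢ B
    A≢B A≡B = q≢0 (trans (sym AB≡q) (trans (cong (D² O A) (sym A≡B)) (D²-self A)))

    A≢A′ : A ≢ antipode M A
    A≢A′ A≡A′ = r≢0 (x*y≡0⇒y≡0 r≢0 (trans (sym AM≡rr) (antipode-fixed⇒D²-centre≡0 M A (sym A≡A′))))

    B≢A′ : B ≢ antipode M A
    B≢A′ B≡A′ = q≢4r² (begin
      q                                ≡⟨ AB≡q ⟨
      D² O A B                         ≡⟨ cong (D² O A) B≡A′ ⟩
      D² O A (antipode M A)            ≡⟨ D²-antipode M A ⟩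
      (1# + 1#) * (1# + 1#) * D² O A M ≡⟨ cong ((1# + 1#) * (1# + 1#) *_) AM≡rr ⟩
      (1# + 1#) * (1# + 1#) * (r * r)  ∎)

module PrimeField (n : ℕ) where
  open FieldOps (FpOps n)
  open ≡ using (_≡_; refl; sym; trans; cong; cong₂; isEquivalence; module ≡-Reasoning)

  private
    p : ℕ
    p = suc n

  reduce : ℕ → Car
  reduce m = m mod p

  toℕ-reduce : ∀ m → toℕ (reduce m) ≡ m % p
  toℕ-reduce m = toℕ-fromℕ< (m%n<n m p)

  reduce-toℕ : ∀ a → reduce (toℕ a) ≡ a
  reduce-toℕ a = toℕ-injective (trans (toℕ-reduce (toℕ a)) (m<n⇒m%n≡m (toℕ<n a)))

  reduce-cong : ∀ m k → m % p ≡ k % p → reduce m ≡ reduce k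
  reduce-cong m k m≡k = toℕ-injective (trans (toℕ-reduce m) (trans m≡k (sym (toℕ-reduce k))))

  -- FpOps n defines _+_ and _*_ as _⊙_ below for ∙ = ℕ._+_ and ∙ = ℕ._*_.
  module Reduced (_∙_ : ℕ → ℕ → ℕ) (%-distrib : ∀ m k → (m ∙ k) % p ≡ ((m % p) ∙ (k % p)) % p) where
    open ≡-Reasoning

    _⊙_ : Car → Car → Car
    a ⊙ b = reduce (toℕ a ∙ toℕ b)

    reduce-absorbˡ : ∀ m k → reduce (toℕ (reduce m) ∙ k) ≡ reduce (m ∙ k)
    reduce-absorbˡ m k = reduce-cong (toℕ (reduce m) ∙ k) (m ∙ k) (begin
      (toℕ (reduce m) ∙ k) % p     ≡⟨ cong (λ t → (t ∙ k) % p) (toℕ-reduce m) ⟩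
      ((m % p) ∙ k) % p            ≡⟨ %-distrib (m % p) k ⟩
      ((m % p % p) ∙ (k % p)) % p  ≡⟨ cong (λ t → (t ∙ (k % p)) % p) (m%n%n≡m%n m p) ⟩
      ((m % p) ∙ (k % p)) % p      ≡⟨ %-distrib m k ⟨
      (m ∙ k) % p                  ∎)

    reduce-absorbʳ : ∀ m k → reduce (m ∙ toℕ (reduce k)) ≡ reduce (m ∙ k)
    reduce-absorbʳ m k = reduce-cong (m ∙ toℕ (reduce k)) (m ∙ k) (begin
      (m ∙ toℕ (reduce k)) % p     ≡⟨ cong (λ t → (m ∙ t) % p) (toℕ-reduce k) ⟩
      (m ∙ (k % p)) % p            ≡⟨ %-distrib m (k % p) ⟩
      ((m % p) ∙ (k % p % p)) % p  ≡⟨ cong (λ t → ((m % p) ∙ t) % p) (m%n%n≡m%n k p) ⟩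
      ((m % p) ∙ (k % p)) % p      ≡⟨ %-distrib m k ⟨
      (m ∙ k) % p                  ∎)

    reduce-homo : ∀ m k → reduce m ⊙ reduce k ≡ reduce (m ∙ k)
    reduce-homo m k = trans (reduce-absorbˡ m (toℕ (reduce k))) (reduce-absorbʳ m k)

    ⊙-assoc : Associative _≡_ _∙_ → Associative _≡_ _⊙_
    ⊙-assoc ∙-assoc a b c = begin
      (a ⊙ b) ⊙ c                       ≡⟨ reduce-absorbˡ (toℕ a ∙ toℕ b) (toℕ c) ⟩
      reduce ((toℕ a ∙ toℕ b) ∙ toℕ c)  ≡⟨ cong reduce (∙-assoc (toℕ a) (toℕ b) (toℕ c)) ⟩
      reduce (toℕ a ∙ (toℕ b ∙ toℕ c))  ≡⟨ reduce-absorbʳ (toℕ a) (toℕ b ∙ toℕ c) ⟨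
      a ⊙ (b ⊙ c)                       ∎

    ⊙-comm : Commutative _≡_ _∙_ → Commutative _≡_ _⊙_
    ⊙-comm ∙-comm a b = cong reduce (∙-comm (toℕ a) (toℕ b))

    ⊙-identityˡ : ∀ {e} → LeftIdentity _≡_ e _∙_ → LeftIdentity _≡_ (reduce e) _⊙_
    ⊙-identityˡ {e} ∙-identityˡ a = begin
      reduce e ⊙ a        ≡⟨ reduce-absorbˡ e (toℕ a) ⟩
      reduce (e ∙ toℕ a)  ≡⟨ cong reduce (∙-identityˡ (toℕ a)) ⟩
      reduce (toℕ a)      ≡⟨ reduce-toℕ a ⟩
      a                   ∎

  private
    module + = Reduced ℕ._+_ (λ m k → %-distribˡ-+ m k p)
    module * = Reduced ℕ._*_ (λ m k → %-distribˡ-* m k p)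

  negate : Car → Car
  negate a = reduce (p ℕ.∸ toℕ a)

  open ≡-Reasoning

  negate-inverseˡ : LeftInverse _≡_ 0# negate _+_
  negate-inverseˡ a = begin
    negate a + a                    ≡⟨ +.reduce-absorbˡ (p ℕ.∸ toℕ a) (toℕ a) ⟩
    reduce (p ℕ.∸ toℕ a ℕ.+ toℕ a)  ≡⟨ cong reduce (ℕ.m∸n+n≡m (ℕ.<⇒≤ (toℕ<n a))) ⟩
    reduce p                        ≡⟨ reduce-cong p 0 (n%n≡0 p) ⟩
    0#                              ∎

  *-distribˡ-+ : _DistributesOverˡ_ _≡_ _*_ _+_
  *-distribˡ-+ a b c = begin
    a * (b + c)                                   ≡⟨ *.reduce-absorbʳ (toℕ a) (toℕ b ℕ.+ toℕ c) ⟩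
    reduce (toℕ a ℕ.* (toℕ b ℕ.+ toℕ c))          ≡⟨ cong reduce (ℕ.*-distribˡ-+ (toℕ a) (toℕ b) (toℕ c)) ⟩
    reduce (toℕ a ℕ.* toℕ b ℕ.+ toℕ a ℕ.* toℕ c)  ≡⟨ +.reduce-homo (toℕ a ℕ.* toℕ b) (toℕ a ℕ.* toℕ c) ⟨
    (a * b) + (a * c)                             ∎

  x-y≡x+negate-y : ∀ a b → a - b ≡ a + negate b
  x-y≡x+negate-y a b = sym (+.reduce-absorbʳ (toℕ a) (p ℕ.∸ toℕ b))

  isCommutativeRing : IsCommutativeRing _≡_ _+_ _*_ negate 0# 1#
  isCommutativeRing = record
    { isRing = record
      { +-isAbelianGroup = record
        { isGroup = record
          { isMonoid = record
            { isSemigroup = record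
              { isMagma = record { isEquivalence = isEquivalence ; ∙-cong = cong₂ _+_ }
              ; assoc   = +.⊙-assoc ℕ.+-assoc
              }
            ; identity = comm∧idˡ⇒id (+.⊙-comm ℕ.+-comm) (+.⊙-identityˡ ℕ.+-identityˡ)
            }
          ; inverse = comm∧invˡ⇒inv (+.⊙-comm ℕ.+-comm) negate-inverseˡ
          ; ⁻¹-cong = cong negate
          }
        ; comm = +.⊙-comm ℕ.+-comm
        }
      ; *-cong     = cong₂ _*_
      ; *-assoc    = *.⊙-assoc ℕ.*-assoc
      ; *-identity = comm∧idˡ⇒id (*.⊙-comm ℕ.*-comm) (*.⊙-identityˡ ℕ.*-identityˡ)
      ; distrib    = *-distribˡ-+ , comm∧distrˡ⇒distrʳ (*.⊙-comm ℕ.*-comm) *-distribˡ-+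
      }
    ; *-comm = *.⊙-comm ℕ.*-comm
    }

  commutativeRing : CommutativeRing 0ℓ 0ℓ
  commutativeRing = record { isCommutativeRing = isCommutativeRing }

  inverse : Prime p → ∀ a → a ≢ 0# → ∃[ b ] a * b ≡ 1#
  inverse p-prime a a≢0
    with coprime-Bézout (prime⇒coprime p-prime {{≢-nonZero (a≢0 ∘ toℕ-injective)}} (toℕ<n a))
  ... | GCD.Bézout.-+ x y 1+xp≡ya = reduce y , (begin
    a * reduce y            ≡⟨ *.reduce-absorbʳ (toℕ a) y ⟩
    reduce (toℕ a ℕ.* y)    ≡⟨ cong reduce (trans (ℕ.*-comm (toℕ a) y) (sym 1+xp≡ya)) ⟩
    reduce (1 ℕ.+ x ℕ.* p)  ≡⟨ reduce-cong (1 ℕ.+ x ℕ.* p) 1 ([m+kn]%n≡m%n 1 x p) ⟩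
    1#                      ∎)
  -- Here y · toℕ a ≡ -1 modulo p, so the inverse is the negation of y.
  ... | GCD.Bézout.+- x y 1+ya≡xp = negate (reduce y) , (begin
    a * negate (reduce y)   ≡⟨ -‿distribʳ-* a (reduce y) ⟨
    negate (a * reduce y)   ≡⟨ inverseˡ-unique 1# (a * reduce y) 1+ay≡0 ⟨
    1#                      ∎)
    where
    open import Algebra.Properties.Ring (CommutativeRing.ring commutativeRing) using (-‿distribʳ-*)
    open import Algebra.Properties.Group (CommutativeRing.+-group commutativeRing) using (inverseˡ-unique)

    1+ay≡0 : 1# + (a * reduce y) ≡ 0#
    1+ay≡0 = begin
      1# + (a * reduce y)         ≡⟨ cong (λ t → 1# + t) (*.reduce-absorbʳ (toℕ a) y) ⟩
      1# + reduce (toℕ a ℕ.* y)   ≡⟨ +.reduce-homo 1 (toℕ a ℕ.* y) ⟩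
      reduce (1 ℕ.+ toℕ a ℕ.* y)  ≡⟨ cong reduce (trans (cong (1 ℕ.+_) (ℕ.*-comm (toℕ a) y)) 1+ya≡xp) ⟩
      reduce (x ℕ.* p)            ≡⟨ reduce-cong (x ℕ.* p) 0 (m*n%n≡0 x p) ⟩
      0#                          ∎

-- For p ≥ 3 the sum 1# + 1# computes to the numeral 2 of Fin p, so the last clause is absurd.
1+1≢0 : ∀ n → Prime (suc n) → suc n ≢ 2 → let open FieldOps (FpOps n) in (1# + 1#) ≢ 0#
1+1≢0 zero          p-prime _   = ⊥-elim (¬prime[1] p-prime)
1+1≢0 (suc zero)    _       p≢2 = ⊥-elim (p≢2 ≡.refl)
1+1≢0 (suc (suc _)) _       _   = λ ()

Fp-char≢2Field : ∀ n → Prime (suc n) → suc n ≢ 2 → Char≢2Field (FpOps n)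
Fp-char≢2Field n p-prime p≢2 = record
  { -_                = negate
  ; isCommutativeRing = isCommutativeRing
  ; x-y≡x+-y          = x-y≡x+negate-y
  ; _≟_               = _≟ᶠ_
  ; inverse           = inverse p-prime
  ; 2≢0               = 1+1≢0 n p-prime p≢2
  }
  where open PrimeField n

ℚ-char≢2Field : Char≢2Field ℚOps
ℚ-char≢2Field = record
  { -_                = ℚ.-_
  ; isCommutativeRing = CommutativeRing.isCommutativeRing ℚ.+-*-commutativeRing
  ; x-y≡x+-y          = λ _ _ → ≡.refl
  ; _≟_               = ℚ._≟_
  ; inverse           = λ x x≢0 → ℚ.1/_ x {{ℚ.≢-nonZero x≢0}} , ℚ.*-inverseʳ x {{ℚ.≢-nonZero x≢0}}
  ; 2≢0               = λ ()
  }

mainTheorem12 : ((n : ℕ) → Prime (suc n) → suc n ≢ 2 → Theorem12For (FpOps n))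
                × Theorem12For ℚOps
mainTheorem12 = (λ n p-prime p≢2 → Circle.theorem12 (Fp-char≢2Field n p-prime p≢2))
              , Circle.theorem12 ℚ-char≢2Field
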